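{- Let $\mathbf{G}$ be a bipartite graph with a consistent $\mathbf{H}$-colouring $c$, and let $\Psi$ be a bipartite property. Let $G$ and $H$ be the underlying graphs of $\mathbf{G}$ and $\mathbf{H}$, respectively. Then \[\#\mathrm{BipIndSub}_c(\Psi,\mathbf{G}) = \sum_{A\subseteq E(\mathbf{H})} \Psi(\mathbf{H}[A]) \cdot \#\mathrm{IndSub}_c(H[A],G)\,.\]
   Context: A bipartite graph is $\mathbf{G}=(V_1,V_2,E)$ with ordered bipartition, underlying graph $(V_1\cup V_2,E)$. A bipartite property is a function from bipartite graphs to $\{0,1\}$ invariant under consistent isomorphisms (isomorphisms mapping the first part to the first part and the second to the second). A consistent $\mathbf{H}$-colouring of $\mathbf{G}$ is a graph homomorphism $c$ from the underlying graph of $\mathbf{G}$ to that of $\mathbf{H}$ with $c(V_i(\mathbf{G}))\subseteq V_i(\mathbf{H})$ for $i=1,2$. For $S\subseteq V(\mathbf{G})$, $\mathbf{G}[S]=(V_1\cap S,V_2\cap S,E')$ with $E'$ the edges inside $S$. For $A\subseteq E(\mathbf{H})$, $\mathbf{H}[A]=(V_1(\mathbf{H}),V_2(\mathbf{H}),A)$ and $H[A]=(V(H),A)$. $\mathrm{BipIndSub}_c(\Psi,\mathbf{G})$ is the set of all $S\subseteq V(\mathbf{G})$ with $|S|=|V(\mathbf{H})|$, $c(S)=V(\mathbf{H})$ and $\Psi(\mathbf{G}[S])=1$. For an $H$-colouring $c$ of $G$ (a homomorphism $G\to H$), $\mathrm{IndSub}_c(H[A],G)$ is the set of all $S\subseteq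 V(G)$ with $|S|=|V(H)|$, $c(S)=V(H)$, such that for all distinct $u,v\in S$: $\{u,v\}\in E(G)$ iff $\{c(u),c(v)\}\in A$. -}

module Defs where

open import Data.Nat using (ℕ; zero; suc; _+_; _*_; _≡ᵇ_)
open import Data.Bool using (Bool; true; false; _∧_; _∨_; not; if_then_else_)
open import Data.Bool.Properties using (∨-comm)
open import Data.Fin using (Fin; zero; suc; _<?_; _≟_)
open import Data.Fin.Subset using (Subset; ∣_∣)
open import Data.List as List using (List; []; _∷_; length; allFin; concatMap; filter)
open import Data.Nat.ListAction using (sum)
open import Data.Bool.ListAction using (all; any)
open import Data.Vec as Vec using (Vec; []; _∷_)
open import Data.Product using (_×_; _,_; proj₁; proj₂)
open import Function.Bundles using (_↔_; Inverse)
open import Relation.Nullary.Decidable using (⌊_⌋)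
open import Relation.Binary.PropositionalEquality using (_≡_; _≢_; refl; cong₂)

-- Finite bipartite graphs on the vertex set Fin n.
-- side v ≡ true  means v ∈ V₁,  side v ≡ false means v ∈ V₂.
-- adj is a symmetric Boolean adjacency relation; every edge joins V₁ and V₂.

record BipGraph (n : ℕ) : Set where
  field
    side : Fin n → Bool
    adj  : Fin n → Fin n → Bool
    adj-sym : ∀ u v → adj u v ≡ adj v u
    adj-bip : ∀ u v → adj u v ≡ true → side u ≢ side v
open BipGraph public

record ConsIso {n : ℕ} (G H : BipGraph n) : Set where
  field
    iso      : Fin n ↔ Fin n
    pres-side : ∀ u → side H (Inverse.to iso u) ≡ side G u
    pres-adj  : ∀ u v → adj H (Inverse.to iso u) (Inverse.to iso v) ≡ adj G u v

record BipProperty : Set₁ where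
  field
    Ψ : ∀ {n} → BipGraph n → Bool
    Ψ-inv : ∀ {n} (G H : BipGraph n) → ConsIso G H → Ψ G ≡ Ψ H
open BipProperty public

record ConsColouring {n h : ℕ} (G : BipGraph n) (H : BipGraph h) : Set where
  field
    col      : Fin n → Fin h
    col-side : ∀ u → side H (col u) ≡ side G u
    col-hom  : ∀ u v → adj G u v ≡ true → adj H (col u) (col v) ≡ true
open ConsColouring public

b2n : Bool → ℕ
b2n true  = 1
b2n false = 0

allSubsets : (n : ℕ) → List (Subset n)
allSubsets zero    = [] ∷ []
allSubsets (suc n) = concatMap (λ s → (false ∷ s) ∷ (true ∷ s) ∷ []) (allSubsets n)

sumSubsets : (n : ℕ) → (Subset n → ℕ) → ℕ
sumSubsets n f = sum (List.map f (allSubsets n))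

countSubsets : (n : ℕ) → (Subset n → Bool) → ℕ
countSubsets n p = sumSubsets n (λ S → b2n (p S))

allB : ∀ {n} → (Fin n → Bool) → Bool
allB {n} p = all p (allFin n)

anyB : ∀ {n} → (Fin n → Bool) → Bool
anyB {n} p = any p (allFin n)

elems : ∀ {n} → Subset n → List (Fin n)
elems []          = []
elems (true ∷ s)  = zero ∷ List.map suc (elems s)
elems (false ∷ s) = List.map suc (elems s)

induced : ∀ {n} (G : BipGraph n) (S : Subset n) → BipGraph (length (elems S))
induced G S = record
  { side = λ i → side G (e i)
  ; adj  = λ i j → adj G (e i) (e j)
  ; adj-sym = λ i j → adj-sym G (e i) (e j)
  ; adj-bip = λ i j → adj-bip G (e i) (e j)
  }
  where e = List.lookup (elems S)

-- The unordered pairs {i,j} (i < j) of Fin h are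
-- listed as `pairs h`; a set of pairs is a Subset of their positions.

pairs : (h : ℕ) → List (Fin h × Fin h)
pairs h = concatMap (λ i → List.map (λ j → (i , j)) (filter (λ j → i <? j) (allFin h))) (allFin h)

NPairs : ℕ → ℕ
NPairs h = length (pairs h)

pairAt : ∀ {h} → Fin (NPairs h) → Fin h × Fin h
pairAt {h} = List.lookup (pairs h)

edgeSubset : ∀ {h} (H : BipGraph h) → Subset (NPairs h) → Bool
edgeSubset H B = allB (λ p → not (Vec.lookup B p) ∨ adj H (proj₁ (pairAt p)) (proj₂ (pairAt p)))

inB : ∀ {h} → Subset (NPairs h) → Fin h → Fin h → Bool
inB B x y = anyB (λ p → Vec.lookup B p ∧ (⌊ proj₁ (pairAt p) ≟ x ⌋ ∧ ⌊ proj₂ (pairAt p) ≟ y ⌋))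

inBsym : ∀ {h} → Subset (NPairs h) → Fin h → Fin h → Bool
inBsym B x y = inB B x y ∨ inB B y x

-- 𝐇[A] = (V₁(H), V₂(H), A); the conjunction with adj H is redundant when A ⊆ E(H)
-- (which is always the case where it is used) and only serves to make it a BipGraph.
subEdges : ∀ {h} (H : BipGraph h) (B : Subset (NPairs h)) → BipGraph h
subEdges H B = record
  { side = side H
  ; adj  = λ x y → adj H x y ∧ inBsym B x y
  ; adj-sym = λ x y → cong₂ _∧_ (adj-sym H x y) (∨-comm (inB B x y) (inB B y x))
  ; adj-bip = λ x y eq → adj-bip H x y (∧-true eq)
  }
  where
  ∧-true : ∀ {a b} → a ∧ b ≡ true → a ≡ true
  ∧-true {true} _ = refl

sizeAndSurj : ∀ {n h} → (Fin n → Fin h) → Subset n → Bool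
sizeAndSurj {n} {h} c S =
  (∣ S ∣ ≡ᵇ h) ∧ allB (λ w → anyB (λ u → Vec.lookup S u ∧ ⌊ c u ≟ w ⌋))

BipIndSub? : ∀ {n h} {G : BipGraph n} {H : BipGraph h} →
             BipProperty → ConsColouring G H → Subset n → Bool
BipIndSub? {G = G} P c S = sizeAndSurj (col c) S ∧ Ψ P (induced G S)

#BipIndSub : ∀ {n h} (P : BipProperty) (G : BipGraph n) {H : BipGraph h} → ConsColouring G H → ℕ
#BipIndSub {n} P G c = countSubsets n (BipIndSub? P c)

-- IndSub_c(H[A], G), where the H-colouring c of G is the underlying map of a
-- (consistent) colouring; F is the graph H[A] (only its edges are used).
IndSub? : ∀ {n h} (F : BipGraph h) (G : BipGraph n) → (Fin n → Fin h) → Subset n → Bool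
IndSub? F G c S = sizeAndSurj c S ∧
  allB (λ u → allB (λ v →
    not (Vec.lookup S u ∧ Vec.lookup S v ∧ not ⌊ u ≟ v ⌋)
    ∨ (if adj G u v then adj F (c u) (c v) else not (adj F (c u) (c v)))))

#IndSub : ∀ {n h} (F : BipGraph h) (G : BipGraph n) → (Fin n → Fin h) → ℕ
#IndSub {n} F G c = countSubsets n (IndSub? F G c)

-- A set S of |V(H)| vertices with c(S) = V(H) is mapped bijectively onto V(H) by c.
-- Transporting the edges of G[S] along this bijection gives the only A ⊆ E(H) for
-- which S ∈ IndSub_c(H[A], G), and c is then a consistent isomorphism G[S] ≅ H[A],
-- so Ψ(G[S]) = Ψ(H[A]). Hence every S contributes Ψ(G[S]) to both sides, and the
-- identity follows by exchanging the two sums.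
module Submission where

open import Defs
open import Data.Bool using (Bool; true; false; _∧_; _∨_; not; if_then_else_)
open import Data.Bool.Properties using (T-≡; ⇔→≡; ¬-not; ∧-zeroʳ; ∧-identityʳ; ∨-identityʳ; ∨-comm)
open import Data.Fin using (Fin; zero; suc; _<_; _<?_; punchOut)
open import Data.Fin.Properties using (_≟_; <-cmp; <-irrefl; <-asym; punchOut-injective; injective⇒≤)
open import Data.Fin.Subset using (Subset; ∣_∣)
open import Data.List as List using (List; []; _∷_; allFin; concatMap; filter; length; lookup)
open import Data.List.Properties using (map-cong; length-map)
open import Data.List.Membership.Propositional using (_∈_)
open import Data.List.Membership.Propositional.Properties
  using (∈-allFin; ∈-lookup; ∈-map⁺; ∈-map⁻; ∈-filter⁺; ∈-filter⁻; ∈-concatMap⁺; ∈-concatMap⁻)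
import Data.List.Relation.Unary.All as All
import Data.List.Relation.Unary.All.Properties as All
open import Data.List.Relation.Unary.Any as Any using (here; there)
open import Data.List.Relation.Unary.Any.Properties using (any⁺; any⁻; lookup-index)
open import Data.List.Relation.Unary.AllPairs as AllPairs using (_∷_)
import Data.List.Relation.Unary.AllPairs.Properties as AllPairs
open import Data.List.Relation.Unary.Unique.Propositional using (Unique)
import Data.List.Relation.Unary.Unique.Propositional.Properties as Unique
open import Data.Nat using (ℕ; zero; suc; _+_; _*_)
open import Data.Nat.ListAction using (sum)
open import Data.Nat.Properties
  using (+-assoc; +-identityʳ; *-zeroʳ; *-distribˡ-+; ≡ᵇ⇒≡; 1+n≰n; +-commutativeSemigroup)
open import Algebra.Properties.CommutativeSemigroup +-commutativeSemigroup using (interchange)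
open import Data.Product using (_×_; _,_; proj₁; proj₂; ∃; uncurry; map₂)
open import Data.Sum using (_⊎_; inj₁; inj₂; [_,_])
open import Data.Vec as Vec using ([]; _∷_; tabulate)
open import Data.Vec.Properties using (∷-injectiveʳ; lookup∘tabulate; tabulate∘lookup; tabulate-cong)
open import Function using (_∘_)
open import Function.Bundles using (_↔_; mk↔ₛ′; mk⇔; Equivalence; Inverse)
open import Function.Definitions using (Injective; StrictlyInverseˡ; StrictlyInverseʳ)
open import Relation.Binary using (tri<; tri≈; tri>)
open import Relation.Binary.PropositionalEquality
  using (_≡_; _≢_; refl; sym; trans; cong; cong₂; subst; subst₂; module ≡-Reasoning)
open import Relation.Nullary using (Dec; yes; no; ¬_; contradiction)
open import Relation.Nullary.Decidable using (⌊_⌋; toWitness; fromWitness)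

open ≡-Reasoning

∧-true⁺ : ∀ {a b} → a ≡ true → b ≡ true → a ∧ b ≡ true
∧-true⁺ refl b≡true = b≡true

∧-true⁻ : ∀ {a b} → a ∧ b ≡ true → a ≡ true × b ≡ true
∧-true⁻ {true} b≡true = refl , b≡true

∧-entailed : ∀ {a} b → (b ≡ true → a ≡ true) → a ∧ b ≡ b
∧-entailed {a} false _ = ∧-zeroʳ a
∧-entailed true b⇒a rewrite b⇒a refl = refl

∨-true⁻ : ∀ {a b} → a ∨ b ≡ true → a ≡ true ⊎ b ≡ true
∨-true⁻ {true}  _        = inj₁ refl
∨-true⁻ {false} b≡true = inj₂ b≡true

implies-true⁺ : ∀ {a b} → (a ≡ true → b ≡ true) → not a ∨ b ≡ true
implies-true⁺ {false} _   = refl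
implies-true⁺ {true}  a⇒b = a⇒b refl

implies-true⁻ : ∀ {a b} → not a ∨ b ≡ true → a ≡ true → b ≡ true
implies-true⁻ a⇒b refl = a⇒b

xnor-true⁻ : ∀ x y → (if x then y else not y) ≡ true → y ≡ x
xnor-true⁻ true  true  _ = refl
xnor-true⁻ false false _ = refl

xnor-true⁺ : ∀ x → (if x then x else not x) ≡ true
xnor-true⁺ true  = refl
xnor-true⁺ false = refl

guard-true⁺ : ∀ a b {P : Set} (P? : Dec P) {q} →
  (a ≡ true → b ≡ true → ¬ P → q ≡ true) → not (a ∧ b ∧ not ⌊ P? ⌋) ∨ q ≡ true
guard-true⁺ true  true  (no ¬p) k = k refl refl ¬p
guard-true⁺ true  true  (yes _) _ = refl
guard-true⁺ true  false _       _ = refl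
guard-true⁺ false _     _       _ = refl

guard-true⁻ : ∀ {a b} {P : Set} (P? : Dec P) {q} →
  not (a ∧ b ∧ not ⌊ P? ⌋) ∨ q ≡ true → a ≡ true → b ≡ true → ¬ P → q ≡ true
guard-true⁻ (yes p) _     _    _    ¬p = contradiction p ¬p
guard-true⁻ (no _)  guard refl refl _  = guard

≟-true⁺ : ∀ {k} {x y : Fin k} → x ≡ y → ⌊ x ≟ y ⌋ ≡ true
≟-true⁺ x≡y = Equivalence.to T-≡ (fromWitness x≡y)

≟-true⁻ : ∀ {k} {x y : Fin k} → ⌊ x ≟ y ⌋ ≡ true → x ≡ y
≟-true⁻ eq = toWitness (Equivalence.from T-≡ eq)

allB-true⁺ : ∀ {n} {p : Fin n → Bool} → (∀ i → p i ≡ true) → allB p ≡ true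
allB-true⁺ {n} {p} p≡true =
  Equivalence.to T-≡ (All.all⁻ p {allFin n} (All.tabulate λ {i} _ → Equivalence.from T-≡ (p≡true i)))

allB-true⁻ : ∀ {n} {p : Fin n → Bool} → allB p ≡ true → ∀ i → p i ≡ true
allB-true⁻ {n} {p} all≡true i =
  Equivalence.to T-≡ (All.lookup (All.all⁺ p (allFin n) (Equivalence.from T-≡ all≡true)) (∈-allFin i))

anyB-true⁺ : ∀ {n} {p : Fin n → Bool} i → p i ≡ true → anyB p ≡ true
anyB-true⁺ {n} {p} i pᵢ≡true =
  Equivalence.to T-≡ (any⁺ p (Any.map (λ { refl → Equivalence.from T-≡ pᵢ≡true }) (∈-allFin i)))

anyB-true⁻ : ∀ {n} {p : Fin n → Bool} → anyB p ≡ true → ∃ λ i → p i ≡ true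
anyB-true⁻ {n} {p} any≡true with i , pᵢ ← Any.satisfied (any⁻ p (allFin n) (Equivalence.from T-≡ any≡true)) =
  i , Equivalence.to T-≡ pᵢ

adj-irrefl : ∀ {n} (G : BipGraph n) u → adj G u u ≡ false
adj-irrefl G u with adj G u u in eq
... | true  = contradiction refl (adj-bip G u u eq)
... | false = refl

Ψ-inv′ : ∀ (P : BipProperty) {m k} (G₁ : BipGraph m) (G₂ : BipGraph k) → m ≡ k → (f : Fin m ↔ Fin k) →
  (∀ u → side G₂ (Inverse.to f u) ≡ side G₁ u) →
  (∀ u v → adj G₂ (Inverse.to f u) (Inverse.to f v) ≡ adj G₁ u v) →
  Ψ P G₁ ≡ Ψ P G₂
Ψ-inv′ P G₁ G₂ refl f pres-side pres-adj =
  Ψ-inv P G₁ G₂ record { iso = f ; pres-side = pres-side ; pres-adj = pres-adj }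

strictlyInverseˡ⇒strictlyInverseʳ : ∀ {m k} → m ≡ k → {f : Fin m → Fin k} {g : Fin k → Fin m} →
  StrictlyInverseˡ _≡_ f g → StrictlyInverseʳ _≡_ f g
strictlyInverseˡ⇒strictlyInverseʳ {zero}  refl _ ()
strictlyInverseˡ⇒strictlyInverseʳ {suc m} refl {f} {g} f∘g≗id i with g (f i) ≟ i
... | yes g∘f≡id = g∘f≡id
... | no  g∘f≢id = contradiction (injective⇒≤ punchOut∘g-injective) 1+n≰n
  where
  -- g (f i) ≢ i forces i ∉ im g, so punchOut i ∘ g injects Fin (suc m) into Fin m
  g-misses-i : ∀ w → i ≢ g w
  g-misses-i w i≡gw = g∘f≢id (trans (cong g (trans (cong f i≡gw) (f∘g≗id w))) (sym i≡gw))

  punchOut∘g-injective : Injective _≡_ _≡_ (λ w → punchOut (g-misses-i w))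
  punchOut∘g-injective {a} {b} eq =
    trans (sym (f∘g≗id a)) (trans (cong f (punchOut-injective (g-misses-i a) (g-misses-i b) eq)) (f∘g≗id b))

Unique⇒lookup-injective : ∀ {A : Set} {xs : List A} → Unique xs → Injective _≡_ _≡_ (lookup xs)
Unique⇒lookup-injective (_    ∷ _)   {zero}  {zero}  _  = refl
Unique⇒lookup-injective (x∉xs ∷ _)   {zero}  {suc j} eq = contradiction eq (All.lookup x∉xs (∈-lookup j))
Unique⇒lookup-injective (x∉xs ∷ _)   {suc i} {zero}  eq = contradiction (sym eq) (All.lookup x∉xs (∈-lookup i))
Unique⇒lookup-injective (_    ∷ xs!) {suc i} {suc j} eq = cong suc (Unique⇒lookup-injective xs! eq)

sum-map-zero : ∀ {A : Set} {f : A → ℕ} → (∀ x → f x ≡ 0) → ∀ xs → sum (List.map f xs) ≡ 0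
sum-map-zero f≡0 []       = refl
sum-map-zero f≡0 (x ∷ xs) = cong₂ _+_ (f≡0 x) (sum-map-zero f≡0 xs)

sum-map-+ : ∀ {A : Set} (f g : A → ℕ) xs →
  sum (List.map (λ x → f x + g x) xs) ≡ sum (List.map f xs) + sum (List.map g xs)
sum-map-+ f g []       = refl
sum-map-+ f g (x ∷ xs) = trans (cong (f x + g x +_) (sum-map-+ f g xs)) (interchange (f x) (g x) _ _)

sum-map-*ˡ : ∀ {A : Set} k (f : A → ℕ) xs → k * sum (List.map f xs) ≡ sum (List.map (λ x → k * f x) xs)
sum-map-*ˡ k f []       = *-zeroʳ k
sum-map-*ˡ k f (x ∷ xs) = trans (*-distribˡ-+ k (f x) _) (cong (k * f x +_) (sum-map-*ˡ k f xs))

sum-map-swap : ∀ {A B : Set} (f : A → B → ℕ) xs ys →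
  sum (List.map (λ a → sum (List.map (f a) ys)) xs) ≡ sum (List.map (λ b → sum (List.map (λ a → f a b) xs)) ys)
sum-map-swap f []       ys = sym (sum-map-zero (λ _ → refl) ys)
sum-map-swap f (x ∷ xs) ys =
  trans (cong (sum (List.map (f x) ys) +_) (sum-map-swap f xs ys)) (sym (sum-map-+ (f x) _ ys))

sumSubsets-suc : ∀ n (f : Subset (suc n) → ℕ) →
  sumSubsets (suc n) f ≡ sumSubsets n (f ∘ (false ∷_)) + sumSubsets n (f ∘ (true ∷_))
sumSubsets-suc n f = split (allSubsets n)
  where
  split : ∀ As → sum (List.map f (concatMap (λ A → (false ∷ A) ∷ (true ∷ A) ∷ []) As))
                 ≡ sum (List.map (f ∘ (false ∷_)) As) + sum (List.map (f ∘ (true ∷_)) As)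
  split []       = refl
  split (A ∷ As) = trans (sym (+-assoc (f (false ∷ A)) (f (true ∷ A)) _))
                         (trans (cong (f (false ∷ A) + f (true ∷ A) +_) (split As))
                                (interchange (f (false ∷ A)) (f (true ∷ A)) _ _))

sumSubsets-zero : ∀ n {f : Subset n → ℕ} → (∀ A → f A ≡ 0) → sumSubsets n f ≡ 0
sumSubsets-zero n f≡0 = sum-map-zero f≡0 (allSubsets n)

sumSubsets-single : ∀ n {f : Subset n → ℕ} A₀ → (∀ A → A ≢ A₀ → f A ≡ 0) → sumSubsets n f ≡ f A₀
sumSubsets-single zero    []           _   = +-identityʳ _
sumSubsets-single (suc n) {f} (false ∷ A₀) f≡0 = begin
  sumSubsets (suc n) f
    ≡⟨ sumSubsets-suc n f ⟩
  sumSubsets n (f ∘ (false ∷_)) + sumSubsets n (f ∘ (true ∷_))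
    ≡⟨ cong₂ _+_ (sumSubsets-single n A₀ λ A A≢A₀ → f≡0 _ (A≢A₀ ∘ ∷-injectiveʳ))
                 (sumSubsets-zero n λ A → f≡0 _ λ ()) ⟩
  f (false ∷ A₀) + 0
    ≡⟨ +-identityʳ _ ⟩
  f (false ∷ A₀) ∎
sumSubsets-single (suc n) {f} (true ∷ A₀) f≡0 = begin
  sumSubsets (suc n) f
    ≡⟨ sumSubsets-suc n f ⟩
  sumSubsets n (f ∘ (false ∷_)) + sumSubsets n (f ∘ (true ∷_))
    ≡⟨ cong₂ _+_ (sumSubsets-zero n λ A → f≡0 _ λ ())
                 (sumSubsets-single n A₀ λ A A≢A₀ → f≡0 _ (A≢A₀ ∘ ∷-injectiveʳ)) ⟩
  f (true ∷ A₀) ∎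

pairs-unique : ∀ h → Unique (pairs h)
pairs-unique h =
  Unique.concat⁺ (All.map⁺ (All.tabulate λ _ → row-unique))
                 (AllPairs.map⁺ (AllPairs.map rows-disjoint (Unique.allFin⁺ h)))
  where
  row : Fin h → List (Fin h × Fin h)
  row i = List.map (λ j → (i , j)) (filter (λ j → i <? j) (allFin h))

  row-unique : ∀ {i} → Unique (row i)
  row-unique {i} = Unique.map⁺ (cong proj₂) (Unique.filter⁺ (λ j → i <? j) (Unique.allFin⁺ h))

  rows-disjoint : ∀ {i j} → i ≢ j → ∀ {v} → ¬ (v ∈ row i × v ∈ row j)
  rows-disjoint i≢j (v∈rowᵢ , v∈rowⱼ) with ∈-map⁻ _ v∈rowᵢ | ∈-map⁻ _ v∈rowⱼ
  ... | _ , _ , refl | _ , _ , eq = i≢j (cong proj₁ eq)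

pairAt-injective : ∀ {h} → Injective _≡_ _≡_ (pairAt {h})
pairAt-injective {h} = Unique⇒lookup-injective (pairs-unique h)

∈-pairs⁻ : ∀ {h} {x y : Fin h} → (x , y) ∈ pairs h → x < y
∈-pairs⁻ {h} xy∈pairs with i , xy∈rowᵢ ← Any.satisfied (∈-concatMap⁻ _ {xs = allFin h} xy∈pairs)
                       with j , j∈filter , refl ← ∈-map⁻ _ xy∈rowᵢ
  = proj₂ (∈-filter⁻ (λ j → i <? j) {xs = allFin h} j∈filter)

∈-pairs⁺ : ∀ {h} {x y : Fin h} → x < y → (x , y) ∈ pairs h
∈-pairs⁺ {h} {x} {y} x<y = ∈-concatMap⁺ _ {xs = allFin h}
  (Any.map (λ { refl → ∈-map⁺ _ (∈-filter⁺ (λ j → x <? j) (∈-allFin y) x<y) }) (∈-allFin x))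

pairAt-< : ∀ {h} p → proj₁ (pairAt {h} p) < proj₂ (pairAt {h} p)
pairAt-< {h} p = ∈-pairs⁻ (∈-lookup {xs = pairs h} p)

pairAt-surjective : ∀ {h} {x y : Fin h} → x < y → ∃ λ p → pairAt p ≡ (x , y)
pairAt-surjective x<y = Any.index xy∈pairs , sym (lookup-index xy∈pairs)
  where xy∈pairs = ∈-pairs⁺ x<y

∈-elems⁺ : ∀ {n} (S : Subset n) {u} → Vec.lookup S u ≡ true → u ∈ elems S
∈-elems⁺ (true  ∷ S) {zero}  _    = here refl
∈-elems⁺ (true  ∷ S) {suc u} u∈S = there (∈-map⁺ suc (∈-elems⁺ S u∈S))
∈-elems⁺ (false ∷ S) {suc u} u∈S = ∈-map⁺ suc (∈-elems⁺ S u∈S)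

∈-elems⁻ : ∀ {n} (S : Subset n) {u} → u ∈ elems S → Vec.lookup S u ≡ true
∈-elems⁻ (true  ∷ S) {zero}  _         = refl
∈-elems⁻ (true  ∷ S) {suc u} (there m) with _ , v∈S , refl ← ∈-map⁻ suc m = ∈-elems⁻ S v∈S
∈-elems⁻ (false ∷ S) {u}     m         with _ , v∈S , refl ← ∈-map⁻ suc m = ∈-elems⁻ S v∈S

length-elems : ∀ {n} (S : Subset n) → length (elems S) ≡ ∣ S ∣
length-elems []          = refl
length-elems (true  ∷ S) = cong suc (trans (length-map suc (elems S)) (length-elems S))
length-elems (false ∷ S) = trans (length-map suc (elems S)) (length-elems S)

inB-true⁺ : ∀ {h} (B : Subset (NPairs h)) {p} → Vec.lookup B p ≡ true →
  uncurry (inB B) (pairAt {h} p) ≡ true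
inB-true⁺ {h} B {p} p∈B =
  anyB-true⁺ p (∧-true⁺ p∈B (∧-true⁺ (≟-true⁺ {x = proj₁ (pairAt {h} p)} refl)
                                      (≟-true⁺ {x = proj₂ (pairAt {h} p)} refl)))

inB-true⁻ : ∀ {h} (B : Subset (NPairs h)) {x y} → inB B x y ≡ true →
  ∃ λ p → Vec.lookup B p ≡ true × pairAt {h} p ≡ (x , y)
inB-true⁻ B inB≡true with p , p∈B&xy ← anyB-true⁻ inB≡true
                     with p∈B , x≡ , y≡ ← map₂ ∧-true⁻ (∧-true⁻ p∈B&xy)
  = p , p∈B , cong₂ _,_ (≟-true⁻ x≡) (≟-true⁻ y≡)

inB-< : ∀ {h} (B : Subset (NPairs h)) {x y} → inB B x y ≡ true → x < y
inB-< {h} B inB≡true with p , _ , pₓᵧ ← inB-true⁻ B inB≡true =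
  subst (λ z → proj₁ z < proj₂ z) pₓᵧ (pairAt-< {h} p)

inB-lookup : ∀ {h} (B : Subset (NPairs h)) {p x y} → pairAt {h} p ≡ (x , y) → inB B x y ≡ Vec.lookup B p
inB-lookup {h} B {p} {x} {y} pₓᵧ = ⇔→≡ {z = true} (mk⇔ to from)
  where
  to : inB B x y ≡ true → Vec.lookup B p ≡ true
  to inB≡true with q , q∈B , qₓᵧ ← inB-true⁻ B inB≡true =
    subst (λ r → Vec.lookup B r ≡ true) (pairAt-injective {h} (trans qₓᵧ (sym pₓᵧ))) q∈B

  from : Vec.lookup B p ≡ true → inB B x y ≡ true
  from p∈B = subst (λ z → uncurry (inB B) z ≡ true) pₓᵧ (inB-true⁺ {h} B p∈B)

inBsym-< : ∀ {h} (B : Subset (NPairs h)) {x y} → x < y → inBsym B x y ≡ inB B x y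
inBsym-< {h} B {x} {y} x<y =
  trans (cong (inB B x y ∨_) (¬-not λ yx∈B → <-asym x<y (inB-< {h} B yx∈B))) (∨-identityʳ _)

edgesOf : ∀ {h} → (Fin h → Fin h → Bool) → Subset (NPairs h)
edgesOf {h} R = tabulate (uncurry R ∘ pairAt {h})

edgesOf-cong : ∀ {h} {R R′ : Fin h → Fin h → Bool} →
  (∀ {x y} → x < y → R x y ≡ R′ x y) → edgesOf R ≡ edgesOf R′
edgesOf-cong {h} R≗R′ = tabulate-cong λ p → R≗R′ (pairAt-< {h} p)

edgesOf-inBsym : ∀ {h} (B : Subset (NPairs h)) → edgesOf {h} (inBsym {h} B) ≡ B
edgesOf-inBsym {h} B =
  trans (tabulate-cong λ p → trans (inBsym-< {h} B (pairAt-< {h} p)) (inB-lookup {h} B refl)) (tabulate∘lookup B)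

inB-edgesOf : ∀ {h} (R : Fin h → Fin h → Bool) {x y} → x < y → inB (edgesOf R) x y ≡ R x y
inB-edgesOf {h} R x<y with p , pₓᵧ ← pairAt-surjective x<y =
  trans (inB-lookup {h} (edgesOf R) pₓᵧ) (trans (lookup∘tabulate _ p) (cong (uncurry R) pₓᵧ))

inBsym-edgesOf : ∀ {h} {R : Fin h → Fin h → Bool} → (∀ x y → R x y ≡ R y x) → (∀ x → R x x ≡ false) →
  ∀ x y → inBsym (edgesOf R) x y ≡ R x y
inBsym-edgesOf {h} {R} R-sym R-irrefl x y with <-cmp x y
... | tri< x<y _ _ = trans (inBsym-< {h} (edgesOf R) x<y) (inB-edgesOf R x<y)
... | tri> _ _ y<x = begin
  inB (edgesOf R) x y ∨ inB (edgesOf R) y x ≡⟨ ∨-comm (inB (edgesOf R) x y) _ ⟩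
  inBsym (edgesOf R) y x                    ≡⟨ inBsym-< {h} (edgesOf R) y<x ⟩
  inB (edgesOf R) y x                       ≡⟨ inB-edgesOf R y<x ⟩
  R y x                                     ≡⟨ R-sym y x ⟩
  R x y                                     ∎
... | tri≈ _ refl _ = trans (cong₂ _∨_ xx∉R xx∉R) (sym (R-irrefl x))
  where
  xx∉R : inB (edgesOf R) x x ≡ false
  xx∉R = ¬-not λ xx∈R → <-irrefl refl (inB-< {h} (edgesOf R) xx∈R)

edgeSubset-edgesOf : ∀ {h} (H : BipGraph h) {R} → (∀ x y → R x y ≡ true → adj H x y ≡ true) →
  edgeSubset H (edgesOf R) ≡ true
edgeSubset-edgesOf {h} H {R} R⊆E = allB-true⁺ λ p → implies-true⁺ λ p∈R →
  R⊆E _ _ (trans (sym (lookup∘tabulate (uncurry R ∘ pairAt {h}) p)) p∈R)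

edgeSubset-inB : ∀ {h} (H : BipGraph h) {B x y} → edgeSubset H B ≡ true → inB B x y ≡ true → adj H x y ≡ true
edgeSubset-inB {h} H {B} B⊆E xy∈B with p , p∈B , pₓᵧ ← inB-true⁻ {h} B xy∈B =
  subst (λ z → uncurry (adj H) z ≡ true) pₓᵧ (implies-true⁻ (allB-true⁻ B⊆E p) p∈B)

adj-subEdges : ∀ {h} (H : BipGraph h) {B} → edgeSubset H B ≡ true →
  ∀ x y → adj (subEdges H B) x y ≡ inBsym B x y
adj-subEdges H {B} B⊆E x y = ∧-entailed (inBsym B x y)
  ([ edgeSubset-inB H {B} B⊆E , trans (adj-sym H x y) ∘ edgeSubset-inB H {B} B⊆E ] ∘ ∨-true⁻)

InducedCopy : ∀ {n h} (F : BipGraph h) (G : BipGraph n) (c : Fin n → Fin h) (S : Subset n) → Set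
InducedCopy F G c S =
  ∀ u v → Vec.lookup S u ≡ true → Vec.lookup S v ≡ true → u ≢ v → adj F (c u) (c v) ≡ adj G u v

IndSub?-true⁺ : ∀ {n h} (F : BipGraph h) (G : BipGraph n) c S →
  sizeAndSurj c S ≡ true → InducedCopy F G c S → IndSub? F G c S ≡ true
IndSub?-true⁺ F G c S size&onto induced = ∧-true⁺ size&onto (allB-true⁺ λ u → allB-true⁺ λ v →
  guard-true⁺ (Vec.lookup S u) (Vec.lookup S v) (u ≟ v) λ u∈S v∈S u≢v →
    subst (λ b → (if adj G u v then b else not b) ≡ true) (sym (induced u v u∈S v∈S u≢v))
          (xnor-true⁺ (adj G u v)))

IndSub?-false : ∀ {n h} (F : BipGraph h) (G : BipGraph n) c S → sizeAndSurj c S ≡ false → IndSub? F G c S ≡ false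
IndSub?-false F G c S ¬size&onto = cong (_∧ _) ¬size&onto

IndSub?-true⁻ : ∀ {n h} (F : BipGraph h) (G : BipGraph n) c S → IndSub? F G c S ≡ true → InducedCopy F G c S
IndSub?-true⁻ F G c S ind u v u∈S v∈S u≢v =
  xnor-true⁻ (adj G u v) _
    (guard-true⁻ (u ≟ v) (allB-true⁻ (allB-true⁻ (proj₂ (∧-true⁻ ind)) u) v) u∈S v∈S u≢v)

b2n-∧ : ∀ a b → b2n a * b2n b ≡ b2n (a ∧ b)
b2n-∧ true  b = +-identityʳ (b2n b)
b2n-∧ false b = refl

b2n-∧-by-cases : ∀ a {b m} → (a ≡ true → b2n b ≡ m) → (a ≡ false → 0 ≡ m) → b2n (a ∧ b) ≡ m
b2n-∧-by-cases true  if-true _        = if-true refl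
b2n-∧-by-cases false _       if-false = if-false refl

summand : ∀ {n h} (G : BipGraph n) (H : BipGraph h) → ConsColouring G H → BipProperty →
  Subset (NPairs h) → Subset n → ℕ
summand G H c P A S = b2n (edgeSubset H A) * (b2n (Ψ P (subEdges H A)) * b2n (IndSub? (subEdges H A) G (col c) S))

summand≡b2n-∧ : ∀ {n h} (G : BipGraph n) (H : BipGraph h) c P A S →
  summand G H c P A S ≡ b2n (edgeSubset H A ∧ Ψ P (subEdges H A) ∧ IndSub? (subEdges H A) G (col c) S)
summand≡b2n-∧ G H c P A S =
  trans (cong (b2n (edgeSubset H A) *_) (b2n-∧ (Ψ P (subEdges H A)) (IndSub? (subEdges H A) G (col c) S)))
        (b2n-∧ (edgeSubset H A) _)

summand-vanishes : ∀ {n h} (G : BipGraph n) (H : BipGraph h) c P A S →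
  IndSub? (subEdges H A) G (col c) S ≡ false → summand G H c P A S ≡ 0
summand-vanishes G H c P A S ind≡false rewrite ind≡false | *-zeroʳ (b2n (Ψ P (subEdges H A))) =
  *-zeroʳ (b2n (edgeSubset H A))

module OntoSubset {n h} {G : BipGraph n} {H : BipGraph h} (c : ConsColouring G H) {S : Subset n}
                  (size&onto : sizeAndSurj (col c) S ≡ true) where

  private
    e : Fin (length (elems S)) → Fin n
    e = lookup (elems S)

    e∈S : ∀ i → Vec.lookup S (e i) ≡ true
    e∈S i = ∈-elems⁻ S (∈-lookup {xs = elems S} i)

  length-elems≡h : length (elems S) ≡ h
  length-elems≡h = trans (length-elems S) (≡ᵇ⇒≡ _ _ (Equivalence.from T-≡ (proj₁ (∧-true⁻ size&onto))))

  col-onto : ∀ w → ∃ λ u → Vec.lookup S u ∧ ⌊ col c u ≟ w ⌋ ≡ true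
  col-onto w = anyB-true⁻ (allB-true⁻ (proj₂ (∧-true⁻ size&onto)) w)

  section : Fin h → Fin n
  section w = proj₁ (col-onto w)

  section-∈ : ∀ w → Vec.lookup S (section w) ≡ true
  section-∈ w = proj₁ (∧-true⁻ (proj₂ (col-onto w)))

  col∘section : ∀ w → col c (section w) ≡ w
  col∘section w = ≟-true⁻ (proj₂ (∧-true⁻ (proj₂ (col-onto w))))

  position : Fin h → Fin (length (elems S))
  position w = Any.index (∈-elems⁺ S (section-∈ w))

  col∘elems : Fin (length (elems S)) → Fin h
  col∘elems = col c ∘ e

  col∘elems-inverseˡ : StrictlyInverseˡ _≡_ col∘elems position
  col∘elems-inverseˡ w = trans (cong (col c) (sym (lookup-index (∈-elems⁺ S (section-∈ w))))) (col∘section w)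

  col∘elems-inverseʳ : StrictlyInverseʳ _≡_ col∘elems position
  col∘elems-inverseʳ =
    strictlyInverseˡ⇒strictlyInverseʳ length-elems≡h {col∘elems} {position} col∘elems-inverseˡ

  section∘col : ∀ {u} → Vec.lookup S u ≡ true → section (col c u) ≡ u
  section∘col u∈S with m ← ∈-elems⁺ S u∈S rewrite lookup-index m = begin
    section (col∘elems i)        ≡⟨ lookup-index (∈-elems⁺ S (section-∈ (col∘elems i))) ⟩
    e (position (col∘elems i))   ≡⟨ cong e (col∘elems-inverseʳ i) ⟩
    e i                          ∎
    where i = Any.index m

  transportedEdges : Subset (NPairs h)
  transportedEdges = edgesOf (λ x y → adj G (section x) (section y))

  transportedEdges⊆E : edgeSubset H transportedEdges ≡ true
  transportedEdges⊆E = edgeSubset-edgesOf H λ x y sxsy∈E →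
    subst₂ (λ a b → adj H a b ≡ true) (col∘section x) (col∘section y) (col-hom c _ _ sxsy∈E)

  adj-transported : ∀ x y → adj (subEdges H transportedEdges) x y ≡ adj G (section x) (section y)
  adj-transported x y = trans (adj-subEdges H {transportedEdges} transportedEdges⊆E x y)
                              (inBsym-edgesOf {h} (λ x y → adj-sym G _ _) (λ x → adj-irrefl G _) x y)

  adj-transported-col : ∀ {u v} → Vec.lookup S u ≡ true → Vec.lookup S v ≡ true →
    adj (subEdges H transportedEdges) (col c u) (col c v) ≡ adj G u v
  adj-transported-col u∈S v∈S = trans (adj-transported _ _) (cong₂ (adj G) (section∘col u∈S) (section∘col v∈S))

  transported-IndSub : IndSub? (subEdges H transportedEdges) G (col c) S ≡ true
  transported-IndSub = IndSub?-true⁺ (subEdges H transportedEdges) G (col c) S size&onto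
    λ _ _ u∈S v∈S _ → adj-transported-col u∈S v∈S

  IndSub-unique : ∀ A → edgeSubset H A ≡ true → IndSub? (subEdges H A) G (col c) S ≡ true →
    A ≡ transportedEdges
  IndSub-unique A A⊆E ind = trans (sym (edgesOf-inBsym {h} A)) (edgesOf-cong agree)
    where
    agree : ∀ {x y} → x < y → inBsym A x y ≡ adj G (section x) (section y)
    agree {x} {y} x<y = begin
      inBsym A x y
        ≡⟨ sym (adj-subEdges H {A} A⊆E x y) ⟩
      adj (subEdges H A) x y
        ≡⟨ sym (cong₂ (adj (subEdges H A)) (col∘section x) (col∘section y)) ⟩
      adj (subEdges H A) (col c (section x)) (col c (section y))
        ≡⟨ IndSub?-true⁻ (subEdges H A) G (col c) S ind _ _ (section-∈ x) (section-∈ y) sx≢sy ⟩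
      adj G (section x) (section y) ∎
      where
      sx≢sy : section x ≢ section y
      sx≢sy sx≡sy = <-irrefl (trans (sym (col∘section x)) (trans (cong (col c) sx≡sy) (col∘section y))) x<y

  Ψ-induced≡Ψ-transported : ∀ P → Ψ P (induced G S) ≡ Ψ P (subEdges H transportedEdges)
  Ψ-induced≡Ψ-transported P =
    Ψ-inv′ P (induced G S) (subEdges H transportedEdges) length-elems≡h
      (mk↔ₛ′ col∘elems position col∘elems-inverseˡ col∘elems-inverseʳ)
      (λ i → col-side c (e i))
      (λ i j → adj-transported-col (e∈S i) (e∈S j))

  sum-summand : ∀ P → sumSubsets (NPairs h) (λ A → summand G H c P A S) ≡ b2n (Ψ P (induced G S))
  sum-summand P = begin
    sumSubsets (NPairs h) (λ A → summand G H c P A S)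
      ≡⟨ sumSubsets-single (NPairs h) transportedEdges vanishes ⟩
    summand G H c P transportedEdges S
      ≡⟨ summand≡b2n-∧ G H c P transportedEdges S ⟩
    b2n (edgeSubset H transportedEdges ∧ Ψ P H[A] ∧ IndSub? H[A] G (col c) S)
      ≡⟨ cong₂ (λ a⊆E ind → b2n (a⊆E ∧ Ψ P H[A] ∧ ind)) transportedEdges⊆E transported-IndSub ⟩
    b2n (Ψ P H[A] ∧ true)
      ≡⟨ cong b2n (trans (∧-identityʳ _) (sym (Ψ-induced≡Ψ-transported P))) ⟩
    b2n (Ψ P (induced G S)) ∎
    where
    H[A] = subEdges H transportedEdges

    vanishes : ∀ A → A ≢ transportedEdges → summand G H c P A S ≡ 0
    vanishes A A≢ = trans (summand≡b2n-∧ G H c P A S) (cong b2n not-both)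
      where
      not-both : edgeSubset H A ∧ Ψ P (subEdges H A) ∧ IndSub? (subEdges H A) G (col c) S ≡ false
      not-both with edgeSubset H A in A⊆E | IndSub? (subEdges H A) G (col c) S in ind
      ... | false | _     = refl
      ... | true  | false = ∧-zeroʳ _
      ... | true  | true  = contradiction (IndSub-unique A A⊆E ind) A≢

expand-BipIndSub? : ∀ {n h} (G : BipGraph n) (H : BipGraph h) (c : ConsColouring G H) P S →
  b2n (sizeAndSurj (col c) S ∧ Ψ P (induced G S)) ≡ sumSubsets (NPairs h) (λ A → summand G H c P A S)
expand-BipIndSub? {h = h} G H c P S = b2n-∧-by-cases (sizeAndSurj (col c) S)
  (λ size&onto → sym (OntoSubset.sum-summand c {S} size&onto P))
  (λ ¬size&onto → sym (sumSubsets-zero (NPairs h) λ A → summand-vanishes G H c P A S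
    (IndSub?-false (subEdges H A) G (col c) S ¬size&onto)))

lemma17 : ∀ {n h} (G : BipGraph n) (H : BipGraph h) (c : ConsColouring G H) (P : BipProperty) →
    #BipIndSub P G c
      ≡ sumSubsets (NPairs h) (λ A →
          b2n (edgeSubset H A) * (b2n (Ψ P (subEdges H A)) * #IndSub (subEdges H A) G (col c)))
lemma17 {n} {h} G H c P = begin
  #BipIndSub P G c
    ≡⟨ cong sum (map-cong (expand-BipIndSub? G H c P) (allSubsets n)) ⟩
  sumSubsets n (λ S → sumSubsets (NPairs h) (λ A → summand G H c P A S))
    ≡⟨ sum-map-swap (λ S A → summand G H c P A S) (allSubsets n) (allSubsets (NPairs h)) ⟩
  sumSubsets (NPairs h) (λ A → sumSubsets n (summand G H c P A))
    ≡⟨ cong sum (map-cong factor-out (allSubsets (NPairs h))) ⟩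
  sumSubsets (NPairs h) (λ A →
    b2n (edgeSubset H A) * (b2n (Ψ P (subEdges H A)) * #IndSub (subEdges H A) G (col c))) ∎
  where
  factor-out : ∀ A → sumSubsets n (summand G H c P A)
    ≡ b2n (edgeSubset H A) * (b2n (Ψ P (subEdges H A)) * #IndSub (subEdges H A) G (col c))
  factor-out A = sym (trans (cong (b2n (edgeSubset H A) *_) (sum-map-*ˡ (b2n (Ψ P (subEdges H A))) _ (allSubsets n)))
                            (sum-map-*ˡ (b2n (edgeSubset H A)) _ (allSubsets n)))
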